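{- For every graph $G$ of minimum degree at least $1$, $\chi_f(G)\le 3$ if and only if $\operatorname{fdom}(\mathcal{S}(G))\ge 3$.
   Context: For a graph $G$, $\mathcal{S}(G)$ is the graph with vertex set $V(G)\cup E(G)$ in which every two distinct vertices of $V(G)$ are adjacent, each edge-vertex $uv\in E(G)$ is adjacent exactly to $u$ and $v$ (so it is the edge-union of the $1$-subdivision of $G$ and a complete graph on $V(G)$). $\chi_f$ denotes the fractional chromatic number. For integers $0<q\le p$, a dominating $(p:q)$-colouring of a graph $H$ is a map $\phi\colon V(H)\to\binom{[p]}{q}$ with $\bigcup_{u\in N[v]}\phi(u)=[p]$ for every vertex $v$; $\operatorname{fdom}(H)$ is the maximum of $p/q$ over such colourings. -}

module Defs where

open import Data.Nat using (ℕ; _≤_; _*_)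
import Data.Nat
open import Data.Fin using (Fin)
import Data.Fin
open import Data.Fin.Subset using (Subset; _∈_; _∩_; ∣_∣; Empty)
open import Data.Bool using (Bool; true; false)
open import Data.Product using (Σ; ∃; ∃-syntax; _×_; proj₁; proj₂; _,_)
open import Data.Sum using (_⊎_)
open import Data.Empty using (⊥)
open import Relation.Binary.PropositionalEquality using (_≡_; _≢_)

record SimpleGraph (n : ℕ) : Set where
  field
    Adj     : Fin n → Fin n → Bool
    sym     : ∀ u v → Adj u v ≡ Adj v u
    irrefl  : ∀ v → Adj v v ≡ false
open SimpleGraph public

MinDegreeAtLeast1 : ∀ {n} → SimpleGraph n → Set
MinDegreeAtLeast1 {n} G = ∀ (v : Fin n) → ∃[ u ] (Adj G v u ≡ true)

Edge : ∀ {n} → SimpleGraph n → Set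
Edge {n} G = Σ (Fin n × Fin n) λ uv → (proj₁ uv Data.Fin.< proj₂ uv) × (Adj G (proj₁ uv) (proj₂ uv) ≡ true)

IsColouring : ∀ {n} → SimpleGraph n → (p q : ℕ) → (Fin n → Subset p) → Set
IsColouring {n} G p q φ =
  (∀ v → ∣ φ v ∣ ≡ q) × (∀ u v → Adj G u v ≡ true → Empty (φ u ∩ φ v))

-- χ_f(G) ≤ 3, where χ_f(G) = min { p/q : G has a (p:q)-colouring, q ≥ 1 }.
FracChromAtMost3 : ∀ {n} → SimpleGraph n → Set
FracChromAtMost3 {n} G =
  ∃[ p ] ∃[ q ] (0 Data.Nat.< q) × (p ≤ 3 * q) × ∃[ φ ] IsColouring G p q φ

IsDomColouring : (V : Set) → (V → V → Set) → (p q : ℕ) → (V → Subset p) → Set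
IsDomColouring V A p q φ =
  (0 Data.Nat.< q) × (q ≤ p) × (∀ v → ∣ φ v ∣ ≡ q) ×
  (∀ (v : V) (c : Fin p) → ∃[ u ] ((u ≡ v ⊎ A v u) × c ∈ φ u))

SVertex : ∀ {n} → SimpleGraph n → Set
SVertex {n} G = Fin n ⊎ Edge G

SAdj : ∀ {n} (G : SimpleGraph n) → SVertex G → SVertex G → Set
SAdj {n} G (_⊎_.inj₁ u) (_⊎_.inj₁ v) = u ≢ v
SAdj {n} G (_⊎_.inj₁ u) (_⊎_.inj₂ ((a , b) , _)) = (u ≡ a) ⊎ (u ≡ b)
SAdj {n} G (_⊎_.inj₂ ((a , b) , _)) (_⊎_.inj₁ u) = (u ≡ a) ⊎ (u ≡ b)
SAdj {n} G (_⊎_.inj₂ _) (_⊎_.inj₂ _) = ⊥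

-- fdom(S(G)) ≥ 3, where fdom is the maximum of p/q over dominating (p:q)-colourings.
FdomSAtLeast3 : ∀ {n} → SimpleGraph n → Set
FdomSAtLeast3 G =
  ∃[ p ] ∃[ q ] (3 * q ≤ p) × ∃[ φ ] IsDomColouring (SVertex G) (SAdj G) p q φ

{-# OPTIONS --safe #-}
-- Given a (p:q)-colouring φ of G with p ≤ 3q, pad it to 3q colours and give each edge-vertex ab
-- the colours missing from φ(a) ∪ φ(b); since φ(a) and φ(b) are disjoint this is a q-set, and
-- then every closed neighbourhood of S(G) sees all 3q colours (a vertex v via an edge at v).
-- Conversely, in a dominating (p:q)-colouring of S(G) the closed neighbourhood {ab, a, b} of an
-- edge-vertex covers [p] with three q-sets, so p ≤ 3q; when also 3q ≤ p they are pairwise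
-- disjoint, so the restriction to V(G) is a (p:q)-colouring.
module Submission where

open import Defs hiding (sym)
open import Data.Nat using (ℕ; zero; suc; _+_; _*_; _∸_; _≤_; _<_; z≤n; s≤s)
open import Data.Nat.Properties
  using (+-suc; +-identityʳ; +-assoc; m≤m+n; m+n∸m≡n; +-monoʳ-≤; +-monoʳ-<; ≤-refl; <-irrefl; module ≤-Reasoning)
open import Data.Product using (_×_; Σ; ∃-syntax; _,_; proj₁; proj₂)
open import Data.Sum using (_⊎_; inj₁; inj₂; [_,_])
open import Data.Bool using (true)
open import Data.Empty using (⊥-elim)
open import Data.Fin using (Fin; zero)
open import Data.Fin.Properties using (<-cmp)
open import Data.Fin.Subset using (Subset; inside; outside; _∈_; _∉_; _⊆_; _∩_; _∪_; ∁; ⊤; ⊥; ∣_∣; Empty; Nonempty)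
open import Data.Fin.Subset.Properties
  using (_∈?_; ∉⊥; x∈⁅y⁆⇒x≡y; ∣⁅x⁆∣≡1; ∣⊥∣≡0; ∣⊤∣≡n; ∣∁p∣≡n∸∣p∣; p⊆q⇒∣p∣≤∣q∣; Empty-unique;
         ∩-comm; ∩-idem; x∈p∪q⁺; x∈p∪q⁻; x∉p⇒x∈∁p; x∉∁p⇒x∈p)
open import Data.Vec using (_∷_; []; padRight)
open import Data.Vec.Properties using (padRight-replicate)
open import Function using (_∘_)
open import Relation.Binary.Definitions using (tri<; tri≈; tri>)
open import Relation.Binary.PropositionalEquality using (_≡_; _≢_; refl; sym; trans; cong; cong₂; subst; module ≡-Reasoning)
open import Relation.Nullary using (yes; no)

private
  variable
    n m : ℕ

∣p∪q∣+∣p∩q∣≡∣p∣+∣q∣ : ∀ (p q : Subset n) → ∣ p ∪ q ∣ + ∣ p ∩ q ∣ ≡ ∣ p ∣ + ∣ q ∣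
∣p∪q∣+∣p∩q∣≡∣p∣+∣q∣ []            []            = refl
∣p∪q∣+∣p∩q∣≡∣p∣+∣q∣ (inside  ∷ p) (inside  ∷ q) = begin
  suc (∣ p ∪ q ∣ + suc ∣ p ∩ q ∣)   ≡⟨ cong suc (+-suc ∣ p ∪ q ∣ ∣ p ∩ q ∣) ⟩
  suc (suc (∣ p ∪ q ∣ + ∣ p ∩ q ∣)) ≡⟨ cong (suc ∘ suc) (∣p∪q∣+∣p∩q∣≡∣p∣+∣q∣ p q) ⟩
  suc (suc (∣ p ∣ + ∣ q ∣))         ≡⟨ cong suc (+-suc ∣ p ∣ ∣ q ∣) ⟨
  suc (∣ p ∣ + suc ∣ q ∣)           ∎
  where open ≡-Reasoning
∣p∪q∣+∣p∩q∣≡∣p∣+∣q∣ (inside  ∷ p) (outside ∷ q) = cong suc (∣p∪q∣+∣p∩q∣≡∣p∣+∣q∣ p q)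
∣p∪q∣+∣p∩q∣≡∣p∣+∣q∣ (outside ∷ p) (inside  ∷ q) =
  trans (cong suc (∣p∪q∣+∣p∩q∣≡∣p∣+∣q∣ p q)) (sym (+-suc ∣ p ∣ ∣ q ∣))
∣p∪q∣+∣p∩q∣≡∣p∣+∣q∣ (outside ∷ p) (outside ∷ q) = ∣p∪q∣+∣p∩q∣≡∣p∣+∣q∣ p q

∣p∪q∣≤∣p∣+∣q∣ : ∀ (p q : Subset n) → ∣ p ∪ q ∣ ≤ ∣ p ∣ + ∣ q ∣
∣p∪q∣≤∣p∣+∣q∣ p q = subst (∣ p ∪ q ∣ ≤_) (∣p∪q∣+∣p∩q∣≡∣p∣+∣q∣ p q) (m≤m+n _ _)

Empty-∩⇒∣p∪q∣≡∣p∣+∣q∣ : ∀ (p q : Subset n) → Empty (p ∩ q) → ∣ p ∪ q ∣ ≡ ∣ p ∣ + ∣ q ∣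
Empty-∩⇒∣p∪q∣≡∣p∣+∣q∣ {n} p q p∩q≡∅ = begin
  ∣ p ∪ q ∣             ≡⟨ +-identityʳ _ ⟨
  ∣ p ∪ q ∣ + 0         ≡⟨ cong (∣ p ∪ q ∣ +_) (∣⊥∣≡0 n) ⟨
  ∣ p ∪ q ∣ + ∣ ⊥ {n} ∣ ≡⟨ cong (λ r → ∣ p ∪ q ∣ + ∣ r ∣) (Empty-unique p∩q≡∅) ⟨
  ∣ p ∪ q ∣ + ∣ p ∩ q ∣ ≡⟨ ∣p∪q∣+∣p∩q∣≡∣p∣+∣q∣ p q ⟩
  ∣ p ∣ + ∣ q ∣         ∎
  where open ≡-Reasoning

Nonempty⇒∣p∣>0 : ∀ {p : Subset n} → Nonempty p → 0 < ∣ p ∣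
Nonempty⇒∣p∣>0 {p = p} (x , x∈p) =
  subst (_≤ ∣ p ∣) (∣⁅x⁆∣≡1 x) (p⊆q⇒∣p∣≤∣q∣ λ y∈⁅x⁆ → subst (_∈ p) (sym (x∈⁅y⁆⇒x≡y x y∈⁅x⁆)) x∈p)

Nonempty-∩⇒∣p∪q∣<∣p∣+∣q∣ : ∀ (p q : Subset n) → Nonempty (p ∩ q) → ∣ p ∪ q ∣ < ∣ p ∣ + ∣ q ∣
Nonempty-∩⇒∣p∪q∣<∣p∣+∣q∣ p q ne = begin-strict
  ∣ p ∪ q ∣             ≡⟨ +-identityʳ _ ⟨
  ∣ p ∪ q ∣ + 0         <⟨ +-monoʳ-< ∣ p ∪ q ∣ (Nonempty⇒∣p∣>0 ne) ⟩
  ∣ p ∪ q ∣ + ∣ p ∩ q ∣ ≡⟨ ∣p∪q∣+∣p∩q∣≡∣p∣+∣q∣ p q ⟩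
  ∣ p ∣ + ∣ q ∣         ∎
  where open ≤-Reasoning

⊤⊆p⇒n≤∣p∣ : ∀ {p : Subset n} → ⊤ {n} ⊆ p → n ≤ ∣ p ∣
⊤⊆p⇒n≤∣p∣ {n} {p} ⊤⊆p = subst (_≤ ∣ p ∣) (∣⊤∣≡n n) (p⊆q⇒∣p∣≤∣q∣ ⊤⊆p)

∣padRight∣ : (m≤n : m ≤ n) (p : Subset m) → ∣ padRight m≤n outside p ∣ ≡ ∣ p ∣
∣padRight∣ {n = n} z≤n [] = ∣⊥∣≡0 n
∣padRight∣ (s≤s m≤n) (inside  ∷ p) = cong suc (∣padRight∣ m≤n p)
∣padRight∣ (s≤s m≤n) (outside ∷ p) = ∣padRight∣ m≤n p

padRight-∩ : (m≤n : m ≤ n) (p q : Subset m) →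
             padRight m≤n outside p ∩ padRight m≤n outside q ≡ padRight m≤n outside (p ∩ q)
padRight-∩ z≤n       []      []      = ∩-idem ⊥
padRight-∩ (s≤s m≤n) (x ∷ p) (y ∷ q) = cong (_ ∷_) (padRight-∩ m≤n p q)

padRight-Empty-∩ : (m≤n : m ≤ n) (p q : Subset m) →
                   Empty (p ∩ q) → Empty (padRight m≤n outside p ∩ padRight m≤n outside q)
padRight-Empty-∩ m≤n p q p∩q≡∅ (x , x∈) =
  ∉⊥ (subst (x ∈_) (trans (padRight-∩ m≤n p q)
                          (trans (cong (padRight m≤n outside) (Empty-unique p∩q≡∅))
                                 (sym (padRight-replicate m≤n outside)))) x∈)

module _ {n} (G : SimpleGraph n) where

  end₁ end₂ : Edge G → Fin n
  end₁ e = proj₁ (proj₁ e)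
  end₂ e = proj₂ (proj₁ e)

  EdgeBetween : Edge G → Fin n → Fin n → Set
  EdgeBetween e u v = (end₁ e ≡ u × end₂ e ≡ v) ⊎ (end₁ e ≡ v × end₂ e ≡ u)

  adj⇒≢ : ∀ {u v} → Adj G u v ≡ true → u ≢ v
  adj⇒≢ {u} uv refl with trans (sym uv) (irrefl G u)
  ... | ()

  edgeBetween : ∀ {u v} → Adj G u v ≡ true → Σ (Edge G) λ e → EdgeBetween e u v
  edgeBetween {u} {v} uv with <-cmp u v
  ... | tri< u<v _ _ = ((u , v) , u<v , uv) , inj₁ (refl , refl)
  ... | tri≈ _ u≡v _ = ⊥-elim (adj⇒≢ uv u≡v)
  ... | tri> _ _ v<u = ((v , u) , v<u , trans (SimpleGraph.sym G v u) uv) , inj₂ (refl , refl)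

  padRight-colouring : ∀ {p p′ q φ} (p≤p′ : p ≤ p′) →
                       IsColouring G p q φ → IsColouring G p′ q (padRight p≤p′ outside ∘ φ)
  padRight-colouring p≤p′ (size , disjoint) =
    (λ v → trans (∣padRight∣ p≤p′ _) (size v)) ,
    (λ u v uv → padRight-Empty-∩ p≤p′ _ _ (disjoint u v uv))

  extendToEdges : ∀ {p} → (Fin n → Subset p) → SVertex G → Subset p
  extendToEdges ψ (inj₁ v) = ψ v
  extendToEdges ψ (inj₂ e) = ∁ (ψ (end₁ e) ∪ ψ (end₂ e))

  colouring⇒domColouring : ∀ {q ψ} → MinDegreeAtLeast1 G → 0 < q → IsColouring G (3 * q) q ψ →
                           IsDomColouring (SVertex G) (SAdj G) (3 * q) q (extendToEdges ψ)
  colouring⇒domColouring {q} {ψ} δ≥1 q>0 (size , disjoint) = q>0 , m≤m+n q _ , size′ , dominates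
    where
    size′ : ∀ x → ∣ extendToEdges ψ x ∣ ≡ q
    size′ (inj₁ v) = size v
    size′ (inj₂ ((a , b) , _ , ab)) = begin
      ∣ ∁ (ψ a ∪ ψ b) ∣           ≡⟨ ∣∁p∣≡n∸∣p∣ (ψ a ∪ ψ b) ⟩
      3 * q ∸ ∣ ψ a ∪ ψ b ∣       ≡⟨ cong (3 * q ∸_) (Empty-∩⇒∣p∪q∣≡∣p∣+∣q∣ _ _ (disjoint a b ab)) ⟩
      3 * q ∸ (∣ ψ a ∣ + ∣ ψ b ∣) ≡⟨ cong₂ (λ r s → 3 * q ∸ (r + s)) (size a) (size b) ⟩
      3 * q ∸ (q + q)             ≡⟨ cong (λ r → q + (q + r) ∸ (q + q)) (+-identityʳ q) ⟩
      q + (q + q) ∸ (q + q)       ≡⟨ cong (_∸ (q + q)) (+-assoc q q q) ⟨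
      q + q + q ∸ (q + q)         ≡⟨ m+n∸m≡n (q + q) q ⟩
      q                           ∎
      where open ≡-Reasoning

    avoided : ∀ {c u v} → c ∉ ψ u → c ∉ ψ v → c ∈ ∁ (ψ u ∪ ψ v)
    avoided c∉ψu c∉ψv = x∉p⇒x∈∁p ([ c∉ψu , c∉ψv ] ∘ x∈p∪q⁻ _ _)

    dominatesVertex : ∀ v c → c ∉ ψ v → ∃[ y ] (SAdj G (inj₁ v) y × c ∈ extendToEdges ψ y)
    dominatesVertex v c c∉ψv with δ≥1 v
    ... | u , vu with c ∈? ψ u
    ... | yes c∈ψu = inj₁ u , adj⇒≢ vu , c∈ψu
    ... | no c∉ψu with edgeBetween vu
    ... | e , inj₁ (refl , refl) = inj₂ e , inj₁ refl , avoided c∉ψv c∉ψu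
    ... | e , inj₂ (refl , refl) = inj₂ e , inj₂ refl , avoided c∉ψu c∉ψv

    dominates : ∀ x c → ∃[ y ] ((y ≡ x ⊎ SAdj G x y) × c ∈ extendToEdges ψ y)
    dominates x c with c ∈? extendToEdges ψ x
    dominates x        c | yes c∈ = x , inj₁ refl , c∈
    dominates (inj₁ v) c | no c∉ψv with dominatesVertex v c c∉ψv
    ... | y , vy , c∈ = y , inj₂ vy , c∈
    dominates (inj₂ e) c | no c∉ with x∈p∪q⁻ _ _ (x∉∁p⇒x∈p c∉)
    ... | inj₁ c∈ = inj₁ (end₁ e) , inj₂ (inj₁ refl) , c∈
    ... | inj₂ c∈ = inj₁ (end₂ e) , inj₂ (inj₂ refl) , c∈

  module _ {p q φ} (dom : IsDomColouring (SVertex G) (SAdj G) p q φ) where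

    endColours : Edge G → Subset p
    endColours e = φ (inj₁ (end₁ e)) ∪ φ (inj₁ (end₂ e))

    private
      size : ∀ x → ∣ φ x ∣ ≡ q
      size = proj₁ (proj₂ (proj₂ dom))

      ∣end₁∣+∣end₂∣≡q+q : (e : Edge G) → ∣ φ (inj₁ (end₁ e)) ∣ + ∣ φ (inj₁ (end₂ e)) ∣ ≡ q + q
      ∣end₁∣+∣end₂∣≡q+q e = cong₂ _+_ (size (inj₁ (end₁ e))) (size (inj₁ (end₂ e)))

      q+[q+q]≡3q : q + (q + q) ≡ 3 * q
      q+[q+q]≡3q = cong (λ r → q + (q + r)) (sym (+-identityʳ q))

    closedNeighbourhood-covers : (e : Edge G) → ⊤ ⊆ φ (inj₂ e) ∪ endColours e
    closedNeighbourhood-covers e {c} _ with proj₂ (proj₂ (proj₂ dom)) (inj₂ e) c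
    ... | _      , inj₁ refl        , c∈ = x∈p∪q⁺ (inj₁ c∈)
    ... | inj₁ _ , inj₂ (inj₁ refl) , c∈ = x∈p∪q⁺ (inj₂ (x∈p∪q⁺ (inj₁ c∈)))
    ... | inj₁ _ , inj₂ (inj₂ refl) , c∈ = x∈p∪q⁺ (inj₂ (x∈p∪q⁺ (inj₂ c∈)))

    p≤q+∣endColours∣ : (e : Edge G) → p ≤ q + ∣ endColours e ∣
    p≤q+∣endColours∣ e = begin
      p                                 ≤⟨ ⊤⊆p⇒n≤∣p∣ (closedNeighbourhood-covers e) ⟩
      ∣ φ (inj₂ e) ∪ endColours e ∣     ≤⟨ ∣p∪q∣≤∣p∣+∣q∣ (φ (inj₂ e)) (endColours e) ⟩
      ∣ φ (inj₂ e) ∣ + ∣ endColours e ∣ ≡⟨ cong (_+ ∣ endColours e ∣) (size (inj₂ e)) ⟩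
      q + ∣ endColours e ∣              ∎
      where open ≤-Reasoning

    domColouring⇒p≤3q : Edge G → p ≤ 3 * q
    domColouring⇒p≤3q e = begin
      p                                                   ≤⟨ p≤q+∣endColours∣ e ⟩
      q + ∣ endColours e ∣                                ≤⟨ +-monoʳ-≤ q (∣p∪q∣≤∣p∣+∣q∣ (φ (inj₁ (end₁ e))) _) ⟩
      q + (∣ φ (inj₁ (end₁ e)) ∣ + ∣ φ (inj₁ (end₂ e)) ∣) ≡⟨ cong (q +_) (∣end₁∣+∣end₂∣≡q+q e) ⟩
      q + (q + q)                                         ≡⟨ q+[q+q]≡3q ⟩
      3 * q                                               ∎
      where open ≤-Reasoning

    domColouring⇒ends-disjoint : 3 * q ≤ p → (e : Edge G) → Empty (φ (inj₁ (end₁ e)) ∩ φ (inj₁ (end₂ e)))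
    domColouring⇒ends-disjoint 3q≤p e shared = <-irrefl refl (begin-strict
      p                                                   ≤⟨ p≤q+∣endColours∣ e ⟩
      q + ∣ endColours e ∣                                <⟨ +-monoʳ-< q (Nonempty-∩⇒∣p∪q∣<∣p∣+∣q∣ _ _ shared) ⟩
      q + (∣ φ (inj₁ (end₁ e)) ∣ + ∣ φ (inj₁ (end₂ e)) ∣) ≡⟨ cong (q +_) (∣end₁∣+∣end₂∣≡q+q e) ⟩
      q + (q + q)                                         ≡⟨ q+[q+q]≡3q ⟩
      3 * q                                               ≤⟨ 3q≤p ⟩
      p                                                   ∎)
      where open ≤-Reasoning

    domColouring⇒colouring : 3 * q ≤ p → IsColouring G p q (φ ∘ inj₁)
    domColouring⇒colouring 3q≤p = size ∘ inj₁ , disjoint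
      where
      disjoint : ∀ u v → Adj G u v ≡ true → Empty (φ (inj₁ u) ∩ φ (inj₁ v))
      disjoint u v uv with edgeBetween uv
      ... | e , inj₁ (refl , refl) = domColouring⇒ends-disjoint 3q≤p e
      ... | e , inj₂ (refl , refl) = subst Empty (∩-comm _ _) (domColouring⇒ends-disjoint 3q≤p e)

χf≤3⇒fdomS≥3 : ∀ {n} (G : SimpleGraph n) → MinDegreeAtLeast1 G → FracChromAtMost3 G → FdomSAtLeast3 G
χf≤3⇒fdomS≥3 G δ≥1 (p , q , q>0 , p≤3q , φ , col) =
  3 * q , q , ≤-refl , extendToEdges G _ , colouring⇒domColouring G δ≥1 q>0 (padRight-colouring G p≤3q col)

fdomS≥3⇒χf≤3 : ∀ {n} (G : SimpleGraph n) → MinDegreeAtLeast1 G → FdomSAtLeast3 G → FracChromAtMost3 G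
-- With no vertices there is no edge-vertex to bound p, but the empty (0:1)-colouring does the job.
fdomS≥3⇒χf≤3 {zero}  G _   _ = 0 , 1 , s≤s z≤n , z≤n , (λ ()) , (λ ()) , (λ ())
fdomS≥3⇒χf≤3 {suc n} G δ≥1 (p , q , 3q≤p , φ , dom) =
  p , q , proj₁ dom , domColouring⇒p≤3q G dom edge , φ ∘ inj₁ , domColouring⇒colouring G dom 3q≤p
  where
  edge : Edge G
  edge = proj₁ (edgeBetween G (proj₂ (δ≥1 zero)))

proposition28 : ∀ (n : ℕ) (G : SimpleGraph n) → MinDegreeAtLeast1 G →
                  (FracChromAtMost3 G → FdomSAtLeast3 G) × (FdomSAtLeast3 G → FracChromAtMost3 G)
proposition28 n G δ≥1 = χf≤3⇒fdomS≥3 G δ≥1 , fdomS≥3⇒χf≤3 G δ≥1
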